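{- Let $G$ be a graph and $F$ a forest, both on $n$ vertices, such that $G$ and $F$ do not pack, $F$ is edge-minimal with this property (for every edge $e$ of $F$, $G$ and $F-e$ pack), $3\Delta(G)+\ell^*(F)=n$, and $\Delta(G)>1$. Let $u'$ be a leaf of $F$, $x'$ its neighbor in $F$, and let $f:V(G)\to V(F)$ be a quasipacking of $G$ with $F$ with $f(u)=u'$, $f(x)=x'$ and conflicting edge $ux$. Then, in the multigraph of $f$: 1. for every $y\in V(G)\setminus\{u,x\}$ there is exactly one link from $u$ to $y$; there is no link from $u$ to $x$; and there are exactly two links from $u$ to $u$; 2. $\deg_G(x)=\deg_G(u)=\Delta(G)$; 3. for every $w\in N_G(u)$, $\deg_F(f(w))\geq 2$; 4. for every $w\notin N_G(u)$, $\deg_F(f(w))\leq 2$.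
   Context: All graphs are finite and simple; $\Delta(G)$ is the maximum degree. Graphs $G,F$ on $n$ vertices pack if there is a bijection $f:V(G)\to V(F)$ with $f(u)f(v)\notin E(F)$ for all $uv\in E(G)$. For a forest $F$, $\ell^*(F)=\sum_{v\in V(F)}\max\{\deg_F(v)-2,0\}$. For a bijection $f:V(G)\to V(F)$, its multigraph has vertex set $V(G)$, a "$G$-edge" $uv$ for each $uv\in E(G)$, and an "$F$-edge" $uv$ for each pair with $f(u)f(v)\in E(F)$. A quasipacking of $G$ with $F$ is a bijection $f$ whose multigraph has exactly one pair of vertices joined by both a $G$-edge and an $F$-edge (and is otherwise simple); that pair is the conflicting edge. A link from $u$ to $y$ is a walk $u,w,y$ of two edges in the multigraph where one of the two edges is a $G$-edge and the other is an $F$-edge ($y=u$ allowed; walks using different edges are different links, so the two parallel edges $ux$ give two links from $u$ to itself). -}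

module Defs where

open import Data.Bool using (Bool; true; false; _∧_; _∨_; not; if_then_else_)
open import Data.Bool.Properties using (∧-comm; ∨-comm)
open import Data.Nat using (ℕ; zero; suc; _+_; _*_; _∸_; _⊔_; _≤_)
open import Data.Fin using (Fin; _≟_)
open import Data.List using (List; []; _∷_; _++_; length; map; foldr; allFin; take)
open import Data.Nat.ListAction using (sum)
open import Data.List.Relation.Unary.Linked using (Linked)
open import Data.List.Relation.Unary.Unique.Propositional using (Unique)
open import Data.Product using (Σ; ∃; _×_; _,_)
open import Data.Sum using (_⊎_)
open import Function.Definitions using (Bijective)
open import Relation.Binary.PropositionalEquality using (_≡_; refl; cong; cong₂; trans)
open import Relation.Nullary using (¬_)
open import Relation.Nullary.Decidable using (⌊_⌋)

record Graph (n : ℕ) : Set where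
  field
    adj    : Fin n → Fin n → Bool
    sym    : ∀ x y → adj x y ≡ adj y x
    irrefl : ∀ x → adj x x ≡ false

open Graph public

Edge : ∀ {n} → Graph n → Fin n → Fin n → Set
Edge G u v = adj G u v ≡ true

ind : Bool → ℕ
ind b = if b then 1 else 0

deg : ∀ {n} → Graph n → Fin n → ℕ
deg {n} G v = sum (map (λ w → ind (adj G v w)) (allFin n))

Δ : ∀ {n} → Graph n → ℕ
Δ {n} G = foldr _⊔_ 0 (map (deg G) (allFin n))

ℓ* : ∀ {n} → Graph n → ℕ
ℓ* {n} F = sum (map (λ v → deg F v ∸ 2) (allFin n))

-- A cycle: a list of ≥ 3 distinct vertices v₀,…,v_k with consecutive
-- vertices adjacent and v_k adjacent to v₀.
IsCycle : ∀ {n} → Graph n → List (Fin n) → Set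
IsCycle G vs = 3 ≤ length vs × Unique vs × Linked (Edge G) (vs ++ take 1 vs)

Forest : ∀ {n} → Graph n → Set
Forest {n} G = ¬ (Σ (List (Fin n)) (λ vs → IsCycle G vs))

Pack : ∀ {n} → Graph n → Graph n → Set
Pack {n} G F = Σ (Fin n → Fin n) λ f →
  Bijective _≡_ _≡_ f × (∀ u v → Edge G u v → ¬ Edge F (f u) (f v))

private
  samePair : ∀ {n} → Fin n → Fin n → Fin n → Fin n → Bool
  samePair a b x y = (⌊ x ≟ a ⌋ ∧ ⌊ y ≟ b ⌋) ∨ (⌊ x ≟ b ⌋ ∧ ⌊ y ≟ a ⌋)

  samePair-sym : ∀ {n} (a b x y : Fin n) → samePair a b x y ≡ samePair a b y x
  samePair-sym a b x y =
    trans (cong₂ _∨_ (∧-comm ⌊ x ≟ a ⌋ ⌊ y ≟ b ⌋) (∧-comm ⌊ x ≟ b ⌋ ⌊ y ≟ a ⌋))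
          (∨-comm (⌊ y ≟ b ⌋ ∧ ⌊ x ≟ a ⌋) (⌊ y ≟ a ⌋ ∧ ⌊ x ≟ b ⌋))

removeEdge : ∀ {n} → Graph n → Fin n → Fin n → Graph n
removeEdge G a b = record
  { adj    = λ x y → adj G x y ∧ not (samePair a b x y)
  ; sym    = λ x y → cong₂ _∧_ (Graph.sym G x y) (cong not (samePair-sym a b x y))
  ; irrefl = λ x → cong (λ t → t ∧ not (samePair a b x x)) (Graph.irrefl G x)
  }

EdgeMinimalNonPack : ∀ {n} → Graph n → Graph n → Set
EdgeMinimalNonPack {n} G F = ∀ (a b : Fin n) → Edge F a b → Pack G (removeEdge F a b)

Conflict : ∀ {n} → Graph n → Graph n → (Fin n → Fin n) → Fin n → Fin n → Set
Conflict G F f a b = Edge G a b × Edge F (f a) (f b)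

QuasipackingWithConflict : ∀ {n} → Graph n → Graph n → (Fin n → Fin n) → Fin n → Fin n → Set
QuasipackingWithConflict G F f u x =
  Bijective _≡_ _≡_ f × Conflict G F f u x ×
  (∀ a b → Conflict G F f a b → (a ≡ u × b ≡ x) ⊎ (a ≡ x × b ≡ u))

-- Number of links from u to y in the multigraph of f: walks u,w,y whose
-- first edge is a G-edge and second an F-edge, or vice versa.
-- (Outside of the conflicting pair there is at most one edge of each kind
-- between two vertices, so walks are determined by w and the edge types.)
links : ∀ {n} → Graph n → Graph n → (Fin n → Fin n) → Fin n → Fin n → ℕ
links {n} G F f u y = sum (map (λ w →
    ind (adj G u w) * ind (adj F (f w) (f y))
  + ind (adj F (f u) (f w)) * ind (adj G w y)) (allFin n))

-- Count the links from u by their middle vertex w.  A G-edge uw followed by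
-- an F-edge contributes deg_F f(w); an F-edge f(u)f(w) forces w = x because
-- f(u) is a leaf, and then contributes deg_G x.  Since ind(uw) · d ≤
-- 2 ind(uw) + (d ∸ 2), the total number of links is at most
-- 2 deg_G u + ℓ*(F) + deg_G x ≤ 3Δ(G) + ℓ*(F) = n.  On the other hand there
-- are two links from u to itself (around the conflicting edge ux) and at
-- least one to every y ∉ {u, x}: otherwise exchanging the images of u and y
-- would pack G with F.  Hence all these inequalities are equalities, which is
-- exactly the content of the four claims.
module Submission where

open import Defs hiding (sym)
open import Data.Nat using (ℕ; _+_; _*_; _≤_; _>_)
open import Data.Fin using (Fin)
open import Data.Product using (_×_)
open import Relation.Binary.PropositionalEquality using (_≡_)
open import Relation.Nullary using (¬_)

open import Data.Nat using (zero; suc; _∸_; _⊔_; z≤n; s≤s)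
open import Data.Nat.Properties hiding (_≟_)
open import Data.Nat.Tactic.RingSolver using (solve-∀)
import Data.Nat.ListAction as List
open import Algebra.Properties.Semiring.Sum +-*-semiring
  using (sum; sum-syntax; sum-cong-≗; sum-replicate-zero; ∑-distrib-+; ∑-comm; sum-permute; *-distribˡ-sum; *-distribʳ-sum)
open import Data.Bool using (Bool; true; false; not)
open import Data.Fin using (zero; suc; _≟_)
import Data.Fin.Properties as Fin
import Data.Fin.Permutation as Perm
import Data.Fin.Permutation.Components as PC
open import Data.List using (allFin; map; tabulate; foldr)
open import Data.List.Properties using (map-tabulate)
open import Data.Product using (_,_; proj₁; proj₂; map₁)
open import Data.Sum using (_⊎_; inj₁; inj₂; [_,_])
open import Function using (_∘_; id)
open import Function.Bundles using (Bijection; mk⤖)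
import Function.Construct.Composition as Compose
open import Function.Definitions using (Bijective)
open import Function.Properties.Inverse using (↔⇒⤖)
open import Function.Properties.Bijection using (⤖⇒↔)
open import Relation.Binary.PropositionalEquality
  using (_≢_; refl; sym; trans; cong; cong₂; subst; subst₂; module ≡-Reasoning)
open import Relation.Nullary using (Dec; yes; no; does; contradiction)
open import Relation.Nullary.Decidable using (dec-true; dec-false)

private variable
  n : ℕ

sum-tabulate : (g : Fin n → ℕ) → List.sum (tabulate g) ≡ sum g
sum-tabulate {zero}  g = refl
sum-tabulate {suc n} g = cong (g zero +_) (sum-tabulate (g ∘ suc))

sum-allFin : (g : Fin n → ℕ) → List.sum (map g (allFin n)) ≡ sum g
sum-allFin g = trans (cong List.sum (map-tabulate id g)) (sum-tabulate g)

sum-mono-≤ : {g h : Fin n → ℕ} → (∀ i → g i ≤ h i) → sum g ≤ sum h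
sum-mono-≤ {zero}  g≤h = z≤n
sum-mono-≤ {suc n} g≤h = +-mono-≤ (g≤h zero) (sum-mono-≤ (g≤h ∘ suc))

≤-antisym₃ : ∀ {a b c} → a ≤ b → b ≤ c → c ≤ a → a ≡ b × b ≡ c
≤-antisym₃ a≤b b≤c c≤a = ≤-antisym a≤b (≤-trans b≤c c≤a) , ≤-antisym b≤c (≤-trans c≤a a≤b)

+-mono-≤-≡ : ∀ {a b c d} → a ≤ b → c ≤ d → a + c ≡ b + d → a ≡ b × c ≡ d
+-mono-≤-≡ {a} {b} {c} {d} a≤b c≤d eq = a≡b , +-cancelˡ-≡ a c d (trans eq (cong (_+ d) (sym a≡b)))
  where
  a≡b : a ≡ b
  a≡b = ≤-antisym a≤b (+-cancelʳ-≤ d b a (≤-trans (≤-reflexive (sym eq)) (+-monoʳ-≤ a c≤d)))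

sum-mono-≤-≡ : {g h : Fin n → ℕ} → (∀ i → g i ≤ h i) → sum g ≡ sum h → ∀ i → g i ≡ h i
sum-mono-≤-≡ {suc n} g≤h eq zero    = proj₁ (+-mono-≤-≡ (g≤h zero) (sum-mono-≤ (g≤h ∘ suc)) eq)
sum-mono-≤-≡ {suc n} g≤h eq (suc i) =
  sum-mono-≤-≡ (g≤h ∘ suc) (proj₂ (+-mono-≤-≡ (g≤h zero) (sum-mono-≤ (g≤h ∘ suc)) eq)) i

≤-sum : (g : Fin n → ℕ) (i : Fin n) → g i ≤ sum g
≤-sum g zero    = m≤m+n _ _
≤-sum g (suc i) = ≤-trans (≤-sum (g ∘ suc) i) (m≤n+m _ (g zero))

+-≤-sum : (g : Fin n → ℕ) {i j : Fin n} → i ≢ j → g i + g j ≤ sum g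
+-≤-sum g {zero}  {zero}  i≢j = contradiction refl i≢j
+-≤-sum g {zero}  {suc j} _   = +-monoʳ-≤ (g zero) (≤-sum (g ∘ suc) j)
+-≤-sum g {suc i} {zero}  _   = subst (_≤ sum g) (+-comm (g zero) _) (+-monoʳ-≤ (g zero) (≤-sum (g ∘ suc) i))
+-≤-sum g {suc i} {suc j} i≢j = ≤-trans (+-≤-sum (g ∘ suc) (i≢j ∘ cong suc)) (m≤n+m _ (g zero))

sum-supported-at : (g : Fin n → ℕ) (i : Fin n) → (∀ j → j ≢ i → g j ≡ 0) → sum g ≡ g i
sum-supported-at {suc n} g zero g≡0 = begin
  g zero + sum (g ∘ suc)     ≡⟨ cong (g zero +_) (sum-cong-≗ (λ j → g≡0 (suc j) λ ())) ⟩
  g zero + sum {n} (λ _ → 0) ≡⟨ cong (g zero +_) (sum-replicate-zero n) ⟩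
  g zero + 0                 ≡⟨ +-identityʳ _ ⟩
  g zero                     ∎
  where open ≡-Reasoning
sum-supported-at {suc n} g (suc i) g≡0 =
  cong₂ _+_ (g≡0 zero λ ()) (sum-supported-at (g ∘ suc) i (λ j j≢i → g≡0 (suc j) (j≢i ∘ Fin.suc-injective)))

sum-ones : sum {n} (λ _ → 1) ≡ n
sum-ones {zero}  = refl
sum-ones {suc n} = cong suc sum-ones

sum-∘-bijective : {f : Fin n → Fin n} → Bijective _≡_ _≡_ f → (g : Fin n → ℕ) → sum (g ∘ f) ≡ sum g
sum-∘-bijective bij g = sym (sum-permute g (⤖⇒↔ (mk⤖ bij)))

ind-true : ∀ {b} → b ≡ true → ind b ≡ 1
ind-true refl = refl

ind-false : ∀ {b} → b ≢ true → ind b ≡ 0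
ind-false {true}  b≢true = contradiction refl b≢true
ind-false {false} _      = refl

ind-not-+-ind : ∀ b → ind (not b) + ind b ≡ 1
ind-not-+-ind true  = refl
ind-not-+-ind false = refl

ind-*-ind≡0 : ∀ {a b} → ind a * ind b ≡ 0 → a ≡ true → b ≢ true
ind-*-ind≡0 () refl refl

capacity : Bool → ℕ → ℕ
capacity b d = ind b * 2 + (d ∸ 2)

ind-*-≤-capacity : ∀ b d → ind b * d ≤ capacity b d
ind-*-≤-capacity true  d = subst (_≤ 2 + (d ∸ 2)) (sym (+-identityʳ d)) (m≤n+m∸n d 2)
ind-*-≤-capacity false d = z≤n

ind-*≡capacity⇒2≤ : ∀ {b} d → ind b * d ≡ capacity b d → b ≡ true → 2 ≤ d
ind-*≡capacity⇒2≤ d eq refl = subst (2 ≤_) (trans (sym eq) (+-identityʳ d)) (m≤m+n 2 (d ∸ 2))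

ind-*≡capacity⇒≤2 : ∀ {b} d → ind b * d ≡ capacity b d → b ≢ true → d ≤ 2
ind-*≡capacity⇒≤2 {true}  d eq b≢true = contradiction refl b≢true
ind-*≡capacity⇒≤2 {false} d eq _      = m∸n≡0⇒m≤n (sym eq)

δ : Fin n → Fin n → ℕ
δ a y = ind (does (y ≟ a))

δ-refl : (a : Fin n) → δ a a ≡ 1
δ-refl a = cong ind (dec-true (a ≟ a) refl)

δ-≢ : {a y : Fin n} → y ≢ a → δ a y ≡ 0
δ-≢ {a = a} {y} y≢a = cong ind (dec-false (y ≟ a) y≢a)

sum-δ : (a : Fin n) → sum (δ a) ≡ 1
sum-δ a = trans (sum-supported-at (δ a) a (λ _ → δ-≢)) (δ-refl a)

module _ (G : Graph n) where

  Edge-sym : ∀ {a b} → Edge G a b → Edge G b a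
  Edge-sym {a} {b} e = trans (Graph.sym G b a) e

  Edge-irrefl : ∀ {a} → ¬ Edge G a a
  Edge-irrefl {a} e with () ← trans (sym e) (irrefl G a)

  deg-sum : ∀ v → deg G v ≡ sum (λ w → ind (adj G v w))
  deg-sum v = sum-allFin (λ w → ind (adj G v w))

  deg≤Δ : ∀ v → deg G v ≤ Δ G
  deg≤Δ v = subst (deg G v ≤_) (cong (foldr _⊔_ 0) (sym (map-tabulate id (deg G)))) (≤-⊔-tabulate (deg G) v)
    where
    ≤-⊔-tabulate : ∀ {m} (h : Fin m → ℕ) i → h i ≤ foldr _⊔_ 0 (tabulate h)
    ≤-⊔-tabulate h zero    = m≤m⊔n _ _
    ≤-⊔-tabulate h (suc i) = ≤-trans (≤-⊔-tabulate (h ∘ suc) i) (m≤n⊔m (h zero) _)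

  leaf-neighbour-unique : ∀ {v a b} → deg G v ≡ 1 → Edge G v a → Edge G v b → a ≡ b
  leaf-neighbour-unique {v} {a} {b} leaf va vb with a ≟ b
  ... | yes a≡b = a≡b
  ... | no  a≢b = contradiction (subst (2 ≤_) leaf 2≤deg) 1+n≰n
    where
    2≤deg : 2 ≤ deg G v
    2≤deg = subst₂ (λ p q → p + q ≤ deg G v) (ind-true va) (ind-true vb)
      (subst (_ ≤_) (sym (deg-sum v)) (+-≤-sum (λ w → ind (adj G v w)) a≢b))

module _ (G F : Graph n) (f : Fin n → Fin n) (u : Fin n) where

  linkVia : Fin n → Fin n → ℕ
  linkVia y w = ind (adj G u w) * ind (adj F (f w) (f y)) + ind (adj F (f u) (f w)) * ind (adj G w y)

  links-sum : ∀ y → links G F f u y ≡ sum (linkVia y)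
  links-sum y = sum-allFin (linkVia y)

  sum-links : Bijective _≡_ _≡_ f →
    sum (links G F f u) ≡ ∑[ w < n ] (ind (adj G u w) * deg F (f w) + ind (adj F (f u) (f w)) * deg G w)
  sum-links bij = begin
    sum (links G F f u)                   ≡⟨ sum-cong-≗ links-sum ⟩
    ∑[ y < n ] (∑[ w < n ] (linkVia y w)) ≡⟨ ∑-comm (λ y w → linkVia y w) ⟩
    ∑[ w < n ] (∑[ y < n ] (linkVia y w)) ≡⟨ sum-cong-≗ links-via ⟩
    ∑[ w < n ] (ind (adj G u w) * deg F (f w) + ind (adj F (f u) (f w)) * deg G w) ∎
    where
    open ≡-Reasoning
    links-via : ∀ w → ∑[ y < n ] (linkVia y w) ≡ ind (adj G u w) * deg F (f w) + ind (adj F (f u) (f w)) * deg G w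
    links-via w = begin
      ∑[ y < n ] (a * F-adj y + b * G-adj y)
        ≡⟨ ∑-distrib-+ (λ y → a * F-adj y) (λ y → b * G-adj y) ⟩
      ∑[ y < n ] (a * F-adj y) + ∑[ y < n ] (b * G-adj y)
        ≡⟨ cong₂ _+_ (sym (*-distribˡ-sum a F-adj)) (sym (*-distribˡ-sum b G-adj)) ⟩
      a * sum F-adj + b * sum G-adj
        ≡⟨ cong₂ (λ p q → a * p + b * q) (trans (sum-∘-bijective bij _) (sym (deg-sum F (f w)))) (sym (deg-sum G w)) ⟩
      a * deg F (f w) + b * deg G w ∎
      where
      a b : ℕ
      a = ind (adj G u w)
      b = ind (adj F (f u) (f w))
      F-adj G-adj : Fin n → ℕ
      F-adj y = ind (adj F (f w) (f y))
      G-adj y = ind (adj G w y)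

data TransposeView (i j : Fin n) : Fin n → Fin n → Set where
  at-i  : TransposeView i j i j
  at-j  : TransposeView i j j i
  fixed : ∀ {k} → k ≢ i → k ≢ j → TransposeView i j k k

transpose-view : (i j k : Fin n) → TransposeView i j k (PC.transpose i j k)
transpose-view i j k with k ≟ i
... | yes refl = at-i
... | no k≢i with k ≟ j
...   | yes refl = at-j
...   | no k≢j = fixed k≢i k≢j

transpose-bijective : (i j : Fin n) → Bijective _≡_ _≡_ (PC.transpose i j)
transpose-bijective i j = Bijection.bijective (↔⇒⤖ (Perm.transpose i j))

module Quasipacking (G F : Graph n) (f : Fin n → Fin n) (u x : Fin n) (Q : QuasipackingWithConflict G F f u x) where

  u~x : Edge G u x
  u~x = proj₁ (proj₁ (proj₂ Q))

  fu~fx : Edge F (f u) (f x)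
  fu~fx = proj₂ (proj₁ (proj₂ Q))

  u≢x : u ≢ x
  u≢x refl = Edge-irrefl G u~x

  private
    conflict-ends : ∀ {a b} → Edge G a b → Edge F (f a) (f b) → (a ≡ u × b ≡ x) ⊎ (a ≡ x × b ≡ u)
    conflict-ends ab fab = proj₂ (proj₂ Q) _ _ (ab , fab)

  transpose-packs : ∀ {y} → y ≢ u → y ≢ x →
    (∀ w → Edge G u w → ¬ Edge F (f w) (f y)) →
    (∀ w → Edge F (f u) (f w) → ¬ Edge G w y) →
    Pack G F
  transpose-packs {y} y≢u y≢x no-GF-link no-FG-link =
    f ∘ PC.transpose u y ,
    Compose.bijective _≡_ _≡_ _≡_ (transpose-bijective u y) (proj₁ Q) ,
    λ a b → no-conflict (transpose-view u y a) (transpose-view u y b)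
    where
    y-not-in-conflict : Edge G u y → ¬ Edge F (f u) (f y)
    y-not-in-conflict uy fufy with conflict-ends uy fufy
    ... | inj₁ (_ , y≡x) = y≢x y≡x
    ... | inj₂ (_ , y≡u) = y≢u y≡u

    no-conflict : ∀ {a b a′ b′} → TransposeView u y a a′ → TransposeView u y b b′ →
      Edge G a b → ¬ Edge F (f a′) (f b′)
    no-conflict at-i          at-i          ab = λ _ → Edge-irrefl G ab
    no-conflict at-i          at-j          ab = y-not-in-conflict ab ∘ Edge-sym F
    no-conflict at-i          (fixed _ _)   ab = no-GF-link _ ab ∘ Edge-sym F
    no-conflict at-j          at-i          ab = y-not-in-conflict (Edge-sym G ab)
    no-conflict at-j          at-j          ab = λ _ → Edge-irrefl G ab
    no-conflict at-j          (fixed _ _)   ab = λ fufb → no-FG-link _ fufb (Edge-sym G ab)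
    no-conflict (fixed _ _)   at-i          ab = no-GF-link _ (Edge-sym G ab)
    no-conflict (fixed _ _)   at-j          ab = λ fafu → no-FG-link _ (Edge-sym F fafu) ab
    no-conflict (fixed a≢u _) (fixed b≢u _) ab = [ a≢u ∘ proj₁ , b≢u ∘ proj₂ ] ∘ conflict-ends ab

  links-positive : ¬ Pack G F → ∀ {y} → y ≢ u → y ≢ x → 1 ≤ links G F f u y
  links-positive no-pack {y} y≢u y≢x with links G F f u y in links≡
  ... | suc _ = s≤s z≤n
  ... | zero  = contradiction (transpose-packs y≢u y≢x no-GF-link no-FG-link) no-pack
    where
    no-link-via : ∀ w → linkVia G F f u y w ≡ 0
    no-link-via w = n≤0⇒n≡0 (subst (linkVia G F f u y w ≤_) (trans (sym (links-sum G F f u y)) links≡)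
                                   (≤-sum (linkVia G F f u y) w))

    no-GF-link : ∀ w → Edge G u w → ¬ Edge F (f w) (f y)
    no-GF-link w = ind-*-ind≡0 (m+n≡0⇒m≡0 _ (no-link-via w))

    no-FG-link : ∀ w → Edge F (f u) (f w) → ¬ Edge G w y
    no-FG-link w = ind-*-ind≡0 (m+n≡0⇒n≡0 _ (no-link-via w))

  links-self : 2 ≤ links G F f u u
  links-self = subst (_≤ links G F f u u) via-x≡2
    (subst (linkVia G F f u u x ≤_) (sym (links-sum G F f u u)) (≤-sum (linkVia G F f u u) x))
    where
    via-x≡2 : linkVia G F f u u x ≡ 2
    via-x≡2 = cong₂ _+_ (cong₂ _*_ (ind-true u~x) (ind-true (Edge-sym F fu~fx)))
                        (cong₂ _*_ (ind-true fu~fx) (ind-true (Edge-sym G u~x)))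

module _ (G F : Graph n) {f : Fin n → Fin n} (bij : Bijective _≡_ _≡_ f) (u : Fin n) where

  sum-leaf-neighbour : ∀ {x} → deg F (f u) ≡ 1 → Edge F (f u) (f x) →
    ∑[ w < n ] (ind (adj F (f u) (f w)) * deg G w) ≡ deg G x
  sum-leaf-neighbour {x} leaf fufx = begin
    ∑[ w < n ] (ind (adj F (f u) (f w)) * deg G w) ≡⟨ sum-supported-at _ x off-x ⟩
    ind (adj F (f u) (f x)) * deg G x              ≡⟨ cong (_* deg G x) (ind-true fufx) ⟩
    1 * deg G x                                    ≡⟨ *-identityˡ _ ⟩
    deg G x                                        ∎
    where
    open ≡-Reasoning
    off-x : ∀ w → w ≢ x → ind (adj F (f u) (f w)) * deg G w ≡ 0
    off-x w w≢x = cong (_* deg G w) (ind-false (λ fufw → w≢x (proj₁ bij (leaf-neighbour-unique F leaf fufw fufx))))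

  sum-capacity : ∑[ w < n ] capacity (adj G u w) (deg F (f w)) ≡ deg G u * 2 + ℓ* F
  sum-capacity = begin
    ∑[ w < n ] capacity (adj G u w) (deg F (f w))
      ≡⟨ ∑-distrib-+ (λ w → G-adj w * 2) (excess ∘ f) ⟩
    ∑[ w < n ] (G-adj w * 2) + sum (excess ∘ f)
      ≡⟨ cong₂ _+_ (sym (*-distribʳ-sum 2 G-adj)) (sum-∘-bijective bij excess) ⟩
    sum G-adj * 2 + sum excess
      ≡⟨ cong₂ _+_ (cong (_* 2) (sym (deg-sum G u))) (sym (sum-allFin excess)) ⟩
    deg G u * 2 + ℓ* F ∎
    where
    open ≡-Reasoning
    G-adj excess : Fin n → ℕ
    G-adj w = ind (adj G u w)
    excess v = deg F v ∸ 2

module _ (u x : Fin n) where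

  -- 2 at u, 0 at x (when u ≢ x) and 1 elsewhere, written without case split so that its sum is computable.
  expected : Fin n → ℕ
  expected y = δ u y + ind (not (does (y ≟ x)))

  sum-expected : sum expected ≡ n
  sum-expected = +-cancelʳ-≡ 1 _ _ (begin
    sum expected + 1                      ≡⟨ cong (sum expected +_) (sym (sum-δ x)) ⟩
    sum expected + sum (δ x)              ≡⟨ sym (∑-distrib-+ expected (δ x)) ⟩
    ∑[ y < n ] (expected y + δ x y)        ≡⟨ sum-cong-≗ expected+δ ⟩
    ∑[ y < n ] (δ u y + 1)                 ≡⟨ ∑-distrib-+ (δ u) (λ _ → 1) ⟩
    sum (δ u) + ∑[ y < n ] 1               ≡⟨ cong₂ _+_ (sum-δ u) sum-ones ⟩
    1 + n                                  ≡⟨ +-comm 1 n ⟩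
    n + 1                                  ∎)
    where
    open ≡-Reasoning
    expected+δ : ∀ y → expected y + δ x y ≡ δ u y + 1
    expected+δ y = trans (+-assoc (δ u y) _ _) (cong (δ u y +_) (ind-not-+-ind (does (y ≟ x))))

  expected-self : u ≢ x → expected u ≡ 2
  expected-self u≢x = cong₂ _+_ (δ-refl u) (cong (ind ∘ not) (dec-false (u ≟ x) u≢x))

  expected-other : ∀ {y} → y ≢ u → y ≢ x → expected y ≡ 1
  expected-other y≢u y≢x = cong₂ _+_ (δ-≢ y≢u) (cong (ind ∘ not) (dec-false (_ ≟ x) y≢x))

  expected-at : x ≢ u → expected x ≡ 0
  expected-at x≢u = cong₂ _+_ (δ-≢ x≢u) (cong (ind ∘ not) (dec-true (x ≟ x) refl))

module Tightness (G F : Graph n) (no-pack : ¬ Pack G F) (budget : 3 * Δ G + ℓ* F ≡ n)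
  (f : Fin n → Fin n) (u x : Fin n) (leaf : deg F (f u) ≡ 1) (Q : QuasipackingWithConflict G F f u x) where

  private
    bij : Bijective _≡_ _≡_ f
    bij = proj₁ Q

    L : Fin n → ℕ
    L = links G F f u

    GF-links-via : Fin n → ℕ
    GF-links-via w = ind (adj G u w) * deg F (f w)

    GF-links≤capacity : ∀ w → GF-links-via w ≤ capacity (adj G u w) (deg F (f w))
    GF-links≤capacity w = ind-*-≤-capacity (adj G u w) (deg F (f w))

    deg-u-bound : deg G u * 2 + ℓ* F ≤ Δ G * 2 + ℓ* F
    deg-u-bound = +-monoˡ-≤ (ℓ* F) (*-monoˡ-≤ 2 (deg≤Δ G u))

  open Quasipacking G F f u x Q public using (u≢x)
  open Quasipacking G F f u x Q using (fu~fx; links-self; links-positive)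

  expected≤links : ∀ y → expected u x y ≤ L y
  expected≤links y = by-cases y (y ≟ u) (y ≟ x)
    where
    by-cases : ∀ y → Dec (y ≡ u) → Dec (y ≡ x) → expected u x y ≤ L y
    by-cases _ (yes refl) _          = subst (_≤ L u) (sym (expected-self u x u≢x)) links-self
    by-cases _ (no _)     (yes refl) = subst (_≤ L x) (sym (expected-at u x (u≢x ∘ sym))) z≤n
    by-cases y (no y≢u)   (no y≢x)   = subst (_≤ L y) (sym (expected-other u x y≢u y≢x)) (links-positive no-pack y≢u y≢x)

  sum-links-leaf : sum L ≡ sum GF-links-via + deg G x
  sum-links-leaf = begin
    sum L
      ≡⟨ sum-links G F f u bij ⟩
    ∑[ w < n ] (GF-links-via w + ind (adj F (f u) (f w)) * deg G w)
      ≡⟨ ∑-distrib-+ GF-links-via _ ⟩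
    sum GF-links-via + ∑[ w < n ] (ind (adj F (f u) (f w)) * deg G w)
      ≡⟨ cong (sum GF-links-via +_) (sum-leaf-neighbour G F bij u leaf fu~fx) ⟩
    sum GF-links-via + deg G x ∎
    where open ≡-Reasoning

  Δ-budget : (Δ G * 2 + ℓ* F) + Δ G ≡ n
  Δ-budget = trans (regroup (Δ G) (ℓ* F)) budget
    where
    regroup : ∀ d l → d * 2 + l + d ≡ 3 * d + l
    regroup = solve-∀

  squeeze : n ≡ sum L × sum L ≡ (deg G u * 2 + ℓ* F) + deg G x
  squeeze = ≤-antisym₃
    (subst (_≤ sum L) (sum-expected u x) (sum-mono-≤ expected≤links))
    (begin
      sum L                                                  ≡⟨ sum-links-leaf ⟩
      sum GF-links-via + deg G x                             ≤⟨ +-monoˡ-≤ (deg G x) (sum-mono-≤ GF-links≤capacity) ⟩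
      ∑[ w < n ] capacity (adj G u w) (deg F (f w)) + deg G x ≡⟨ cong (_+ deg G x) (sum-capacity G F bij u) ⟩
      (deg G u * 2 + ℓ* F) + deg G x                         ∎)
    (begin
      (deg G u * 2 + ℓ* F) + deg G x ≤⟨ +-mono-≤ deg-u-bound (deg≤Δ G x) ⟩
      (Δ G * 2 + ℓ* F) + Δ G         ≡⟨ Δ-budget ⟩
      n                              ∎)
    where open ≤-Reasoning

  links≡expected : ∀ y → L y ≡ expected u x y
  links≡expected y = sym (sum-mono-≤-≡ expected≤links (trans (sum-expected u x) (proj₁ squeeze)) y)

  GF-links≡capacity : ∀ w → GF-links-via w ≡ capacity (adj G u w) (deg F (f w))
  GF-links≡capacity = sum-mono-≤-≡ GF-links≤capacity (+-cancelʳ-≡ (deg G x) _ _ (begin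
    sum GF-links-via + deg G x                              ≡⟨ sum-links-leaf ⟨
    sum L                                                   ≡⟨ proj₂ squeeze ⟩
    (deg G u * 2 + ℓ* F) + deg G x                          ≡⟨ cong (_+ deg G x) (sum-capacity G F bij u) ⟨
    ∑[ w < n ] capacity (adj G u w) (deg F (f w)) + deg G x ∎))
    where open ≡-Reasoning

  degrees≡Δ : deg G u ≡ Δ G × deg G x ≡ Δ G
  degrees≡Δ = map₁ (λ eq → *-cancelʳ-≡ _ _ 2 (+-cancelʳ-≡ (ℓ* F) _ _ eq))
    (+-mono-≤-≡ deg-u-bound (deg≤Δ G x)
      (trans (sym (trans (proj₁ squeeze) (proj₂ squeeze))) (sym Δ-budget)))

lemma2p1 : ∀ {n : ℕ} (G F : Graph n) → Forest F →
    ¬ Pack G F → EdgeMinimalNonPack G F →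
    3 * Δ G + ℓ* F ≡ n → Δ G > 1 →
    ∀ (f : Fin n → Fin n) (u x : Fin n) →
    deg F (f u) ≡ 1 → Edge F (f u) (f x) →
    QuasipackingWithConflict G F f u x →
    ((∀ y → ¬ y ≡ u → ¬ y ≡ x → links G F f u y ≡ 1) ×
     links G F f u x ≡ 0 × links G F f u u ≡ 2) ×
    (deg G x ≡ Δ G × deg G u ≡ Δ G) ×
    (∀ w → Edge G u w → 2 ≤ deg F (f w)) ×
    (∀ w → ¬ Edge G u w → deg F (f w) ≤ 2)
lemma2p1 G F _ no-pack _ budget _ f u x leaf _ Q =
  ( (λ y y≢u y≢x → trans (links≡expected y) (expected-other u x y≢u y≢x))
  , trans (links≡expected x) (expected-at u x (u≢x ∘ sym))
  , trans (links≡expected u) (expected-self u x u≢x) )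
  , (proj₂ degrees≡Δ , proj₁ degrees≡Δ)
  , (λ w → ind-*≡capacity⇒2≤ (deg F (f w)) (GF-links≡capacity w))
  , (λ w → ind-*≡capacity⇒≤2 (deg F (f w)) (GF-links≡capacity w))
  where open Tightness G F no-pack budget f u x leaf Q
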